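{- If $d\ge1$, $m\ge0$ and $n\ge m+d+1$, then \[ a_{n,m}=(d+1)!\sum_{\substack{i_1+i_2+\cdots+i_{m+1}=n-1-d-m\\ i_j\ge0}}(i_1+1)(i_1+i_2+1)\cdots(i_1+i_2+\cdots+i_m+1)\prod_{j=1}^{m+1}(d+j)^{i_j}. \]
   Context: For $\sigma\in\mathcal S_n$ (permutations of $[n]$), write $\sigma$ in standard cycle form (each cycle begins with its smallest element, cycles ordered left to right by increasing smallest elements) and let $\mathrm{Flatten}(\sigma)=s_1\cdots s_n$ be the word obtained by erasing the parentheses. For $d\ge1$, a flattened $d$-descent of $\sigma$ is an index $i\in[n-1]$ with $s_i-s_{i+1}\ge d$. Let $a_{n,m}=a_{n,m}(d)$ be the number of permutations of $[n]$ having exactly $m$ flattened $d$-descents. For $m=0$ the product $(i_1+1)\cdots(i_1+\cdots+i_m+1)$ is empty, i.e. equal to $1$. -}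

module Defs where

open import Data.Nat using (ℕ; zero; suc; _+_; _*_; _∸_; _^_; _≡ᵇ_; _≤ᵇ_)
open import Data.Bool using (Bool; true; false; if_then_else_; _∨_)
open import Data.List using (List; []; _∷_; _++_; map; upTo; concatMap; length)

-- A permutation σ of [n] = {1,…,n} is given in one-line notation as the
-- list σ(1) σ(2) … σ(n) (a rearrangement of 1 … n).
range1 : ℕ → List ℕ
range1 n = map suc (upTo n)

-- σ(a) = the a-th entry (1-indexed) of the one-line word.
nth : List ℕ → ℕ → ℕ
nth []       _       = 0
nth (x ∷ xs) zero    = x
nth (x ∷ xs) (suc k) = nth xs k

app : List ℕ → ℕ → ℕ
app w a = nth w (a ∸ 1)

elemᵇ : ℕ → List ℕ → Bool
elemᵇ a []       = false
elemᵇ a (x ∷ xs) = (a ≡ᵇ x) ∨ elemᵇ a xs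

orbit : ℕ → (ℕ → ℕ) → ℕ → ℕ → List ℕ
orbit zero    f a x = []
orbit (suc k) f a x = x ∷ (if f x ≡ᵇ a then [] else orbit k f a (f x))

-- the cycle of σ containing a, written starting from a (a cycle has length ≤ n)
cycleOf : List ℕ → ℕ → List ℕ
cycleOf w a = orbit (length w) (app w) a a

-- Standard cycle form, parentheses erased: scan a = 1,2,…,n; the first
-- element not yet written is the smallest element of a new cycle, which is
-- then written starting from it.
flattenGo : List ℕ → List ℕ → List ℕ → List ℕ
flattenGo w []       acc = acc
flattenGo w (a ∷ as) acc =
  if elemᵇ a acc then flattenGo w as acc else flattenGo w as (acc ++ cycleOf w a)

Flatten : List ℕ → List ℕ
Flatten w = flattenGo w (range1 (length w)) []

dDescents : ℕ → List ℕ → ℕ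
dDescents d []            = 0
dDescents d (x ∷ [])      = 0
dDescents d (x ∷ y ∷ r)   = (if (d + y) ≤ᵇ x then 1 else 0) + dDescents d (y ∷ r)

flatDesc : ℕ → List ℕ → ℕ
flatDesc d σ = dDescents d (Flatten σ)

countFlat : ℕ → ℕ → List (List ℕ) → ℕ
countFlat d m []       = 0
countFlat d m (σ ∷ σs) = (if flatDesc d σ ≡ᵇ m then 1 else 0) + countFlat d m σs

compositions : ℕ → ℕ → List (List ℕ)
compositions zero    N = if N ≡ᵇ 0 then [] ∷ [] else []
compositions (suc k) N =
  concatMap (λ i → map (i ∷_) (compositions k (N ∸ i))) (upTo (suc N))

-- (i_1+1)(i_1+i_2+1)⋯(i_1+⋯+i_m+1) for a list of length m+1 (running sum s)
prefixProd : ℕ → List ℕ → ℕ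
prefixProd s []          = 1
prefixProd s (x ∷ [])    = 1
prefixProd s (x ∷ y ∷ r) = (s + x + 1) * prefixProd (s + x) (y ∷ r)

powProd : ℕ → ℕ → List ℕ → ℕ
powProd d j []       = 1
powProd d j (x ∷ xs) = (d + j) ^ x * powProd d (suc j) xs

sumList : List ℕ → ℕ
sumList []       = 0
sumList (x ∷ xs) = x + sumList xs

weight : ℕ → List ℕ → ℕ
weight d is = prefixProd 0 is * powProd d 1 is

rhs : ℕ → ℕ → ℕ → ℕ
rhs n m d = sumList (map (weight d) (compositions (suc m) (n ∸ 1 ∸ d ∸ m)))

-- Every permutation of [n+1] arises exactly once from a permutation of [n] by inserting n+1 into
-- its cycle structure, either as a new fixed point or right after some i on the cycle of i; on the
-- flattened word this appends n+1, or inserts it right after i. As n+1 exceeds every entry, the new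
-- pair (i, n+1) is never a d-descent and (n+1, h) is one iff h ≤ n+1-d. Hence the number D of
-- flattened d-descents is unchanged at the end, after the last entry, after the first entry of each
-- of the D descents, and before each of the d-1 entries h > n+1-d (none of which is the leading 1),
-- and grows by one in the other n-D-d cases. So for n ≥ d
--   a(n+1, m) = (m+d+1) a(n, m) + (n-m+1-d) a(n, m-1),   a(d, m) = d! [m = 0],
-- and splitting off the first part of a composition shows that the right-hand side, divided by
-- (d+1)!, satisfies the same recurrence.

module Submission where

open import Defs
open import Data.Nat using (ℕ; zero; suc; _+_; _*_; _∸_; _^_; _≤_; _<_; _≡ᵇ_; _≤ᵇ_; z≤n; s≤s; _!)
open import Data.Nat.Properties
open import Data.Nat.Solver using (module +-*-Solver)
open +-*-Solver using (solve; _:+_; _:*_; _:=_; con)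
open import Algebra.Properties.CommutativeSemigroup *-commutativeSemigroup using (x∙yz≈y∙xz)
open import Data.Bool using (true; false; if_then_else_; _∨_; T)
open import Data.Bool.Properties using (∨-zeroʳ)
open import Data.List using (List; []; _∷_; _++_; map; upTo; concatMap; length; [_]; initLast; _∷ʳ′_)
open import Data.List.Properties
  using ( ∷-injective; ∷ʳ-injective; ++-assoc; length-++; ++-identityʳ; map-++; map-∘; map-cong-local
        ; length-map; length-upTo; upTo-∷ʳ; map-upTo; map-applyUpTo)
open import Data.List.Membership.Propositional using (_∈_; _∉_)
open import Data.List.Membership.Propositional.Properties
  using (∈-++⁻; ∈-map⁺; ∈-map⁻; ∈-upTo⁺; ∈-upTo⁻; ∈-concat⁺′; ∈-∃++)
open import Data.List.Membership.Propositional.Properties.WithK using (unique∧set⇒bag)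
open import Data.List.Relation.Unary.Any using (here; there)
open import Data.List.Relation.Unary.All using (All; []; _∷_)
import Data.List.Relation.Unary.All as All
import Data.List.Relation.Unary.All.Properties as All
open import Data.List.Relation.Unary.AllPairs using ([]; _∷_)
open import Data.List.Relation.Unary.Unique.Propositional using (Unique)
import Data.List.Relation.Unary.Unique.Propositional.Properties as Unique
open import Data.List.Relation.Binary.Permutation.Propositional
  using (_↭_; prep; swap; ↭-refl; ↭-sym; ↭-trans)
open import Data.List.Relation.Binary.Permutation.Propositional.Properties
  using (∷↭∷ʳ; ∈-resp-↭; ++⁺ˡ; ++⁺ʳ; ↭-length; ↭-empty-inv; All-resp-↭; drop-mid)
import Data.List.Relation.Binary.Permutation.Propositional.Properties as ↭
open import Data.List.Relation.Binary.BagAndSetEquality using (∼bag⇒↭)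
open import Data.Product using (∃; ∃₂; _×_; _,_; proj₁; proj₂)
open import Data.Sum using (_⊎_; inj₁; inj₂)
open import Data.Empty using (⊥-elim)
open import Function using (_∘′_)
open import Function.Bundles using (_⇔_; mk⇔; Equivalence)
open import Relation.Nullary using (¬_; Dec; yes; no)
open import Relation.Binary.PropositionalEquality
  using (_≡_; _≢_; refl; sym; trans; cong; cong₂; subst; subst₂; module ≡-Reasoning)

private variable
  A B C : Set

≡ᵇ-true : ∀ m n → m ≡ n → (m ≡ᵇ n) ≡ true
≡ᵇ-true zero    zero    _ = refl
≡ᵇ-true (suc m) (suc n) e = ≡ᵇ-true m n (suc-injective e)

≡ᵇ-false : ∀ m n → m ≢ n → (m ≡ᵇ n) ≡ false
≡ᵇ-false zero    zero    m≢n = ⊥-elim (m≢n refl)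
≡ᵇ-false zero    (suc n) _   = refl
≡ᵇ-false (suc m) zero    _   = refl
≡ᵇ-false (suc m) (suc n) m≢n = ≡ᵇ-false m n (m≢n ∘′ cong suc)

≤ᵇ-true : ∀ m n → m ≤ n → (m ≤ᵇ n) ≡ true
≤ᵇ-true m n m≤n with m ≤ᵇ n in eq
... | true  = refl
... | false = ⊥-elim (subst T eq (≤⇒≤ᵇ m≤n))

≤ᵇ-false : ∀ m n → ¬ m ≤ n → (m ≤ᵇ n) ≡ false
≤ᵇ-false m n m≰n with m ≤ᵇ n in eq
... | true  = ⊥-elim (m≰n (≤ᵇ⇒≤ m n (subst T (sym eq) _)))
... | false = refl

≤ᵇ-shift : ∀ d h M → d ≤ M → (d + h ≤ᵇ M) ≡ (h ≤ᵇ M ∸ d)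
≤ᵇ-shift d h M d≤M with h ≤? M ∸ d
... | yes h≤ = trans (≤ᵇ-true (d + h) M (≤-trans (+-monoʳ-≤ d h≤) (≤-reflexive (m+[n∸m]≡n d≤M))))
                     (sym (≤ᵇ-true h (M ∸ d) h≤))
... | no h≰ = trans (≤ᵇ-false (d + h) M (λ d+h≤M → h≰ (subst (_≤ M ∸ d) (m+n∸m≡n d h) (∸-monoˡ-≤ d d+h≤M))))
                    (sym (≤ᵇ-false h (M ∸ d) h≰))

InRange : ℕ → ℕ → Set
InRange n y = 1 ≤ y × y ≤ n

InRange-suc : ∀ {n y} → InRange n y → InRange (suc n) y
InRange-suc (1≤y , y≤n) = 1≤y , m≤n⇒m≤1+n y≤n

InRange⇒≢suc : ∀ {n y} → InRange n y → y ≢ suc n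
InRange⇒≢suc (_ , y≤n) refl = 1+n≰n y≤n

InRange⇒pred< : ∀ {n y} → InRange n y → y ∸ 1 < n
InRange⇒pred< {y = suc y} (_ , y<n) = y<n

range1-suc : ∀ n → range1 (suc n) ≡ range1 n ++ [ suc n ]
range1-suc n = trans (cong (map suc) (sym (upTo-∷ʳ n))) (map-++ suc (upTo n) [ n ])

∈-range1⁻ : ∀ n {y} → y ∈ range1 n → InRange n y
∈-range1⁻ n y∈ with ∈-map⁻ suc y∈
... | x , x∈ , refl = s≤s z≤n , ∈-upTo⁻ x∈

∈-range1⁺ : ∀ n {y} → InRange n y → y ∈ range1 n
∈-range1⁺ n {suc y} (_ , y<n) = ∈-map⁺ suc (∈-upTo⁺ y<n)

All-InRange-range1 : ∀ n → All (InRange n) (range1 n)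
All-InRange-range1 n = All.tabulate (∈-range1⁻ n)

range1-unique : ∀ n → Unique (range1 n)
range1-unique n = Unique.map⁺ suc-injective (Unique.upTo⁺ n)

length-range1 : ∀ n → length (range1 n) ≡ n
length-range1 n = trans (length-map suc (upTo n)) (length-upTo n)

length-↭-range1 : ∀ {n w} → w ↭ range1 n → length w ≡ n
length-↭-range1 {n} w↭ = trans (↭-length w↭) (length-range1 n)

Unique-resp-↭ : ∀ {xs ys : List A} → xs ↭ ys → Unique xs → Unique ys
Unique-resp-↭ (_↭_.refl) u = u
Unique-resp-↭ (prep x p) (x∉ ∷ u) = All-resp-↭ p x∉ ∷ Unique-resp-↭ p u
Unique-resp-↭ (swap x y p) ((x≢y ∷ x∉) ∷ y∉ ∷ u) =
  ((x≢y ∘′ sym) ∷ All-resp-↭ p y∉) ∷ All-resp-↭ p x∉ ∷ Unique-resp-↭ p u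
Unique-resp-↭ (_↭_.trans p q) u = Unique-resp-↭ q (Unique-resp-↭ p u)

∈-concatMap-map⁻ : ∀ (F : A → B → C) xs ys {v} → v ∈ concatMap (λ a → map (F a) ys) xs →
  ∃₂ λ a b → a ∈ xs × b ∈ ys × v ≡ F a b
∈-concatMap-map⁻ F (x ∷ xs) ys v∈ with ∈-++⁻ (map (F x) ys) v∈
... | inj₁ v∈x with ∈-map⁻ (F x) v∈x
...   | b , b∈ , v≡ = x , b , here refl , b∈ , v≡
∈-concatMap-map⁻ F (x ∷ xs) ys v∈ | inj₂ v∈xs with ∈-concatMap-map⁻ F xs ys v∈xs
...   | a , b , a∈ , b∈ , v≡ = a , b , there a∈ , b∈ , v≡

Unique-map : ∀ (f : A → B) {ys} → (∀ {b b′} → b ∈ ys → b′ ∈ ys → f b ≡ f b′ → b ≡ b′) →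
  Unique ys → Unique (map f ys)
Unique-map f inj []        = []
Unique-map f inj (y∉ ∷ u) =
  All.map⁺ (All.tabulate λ b∈ fy≡fb → All.lookup y∉ b∈ (inj (here refl) (there b∈) fy≡fb))
  ∷ Unique-map f (λ b∈ b′∈ → inj (there b∈) (there b′∈)) u

Unique-concatMap-map : ∀ (F : A → B → C) xs ys → Unique xs → Unique ys →
  (∀ {a a′ b b′} → a ∈ xs → a′ ∈ xs → b ∈ ys → b′ ∈ ys → F a b ≡ F a′ b′ → a ≡ a′ × b ≡ b′) →
  Unique (concatMap (λ a → map (F a) ys) xs)
Unique-concatMap-map F []       ys _          _  _   = []
Unique-concatMap-map F (x ∷ xs) ys (x∉ ∷ ux) uy inj =
  Unique.++⁺ (Unique-map (F x) (λ b∈ b′∈ e → proj₂ (inj (here refl) (here refl) b∈ b′∈ e)) uy)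
             (Unique-concatMap-map F xs ys ux uy (λ a∈ a′∈ → inj (there a∈) (there a′∈)))
             disjoint
  where
  disjoint : ∀ {v} → ¬ (v ∈ map (F x) ys × v ∈ concatMap (λ a → map (F a) ys) xs)
  disjoint (v∈x , v∈xs) with ∈-map⁻ (F x) v∈x | ∈-concatMap-map⁻ F xs ys v∈xs
  ... | b , b∈ , refl | a , b′ , a∈ , b′∈ , e = All.lookup x∉ a∈ (proj₁ (inj (here refl) (there a∈) b∈ b′∈ e))

∑ : (A → ℕ) → List A → ℕ
∑ f xs = sumList (map f xs)

sumList-++ : ∀ xs ys → sumList (xs ++ ys) ≡ sumList xs + sumList ys
sumList-++ []       ys = refl
sumList-++ (x ∷ xs) ys = trans (cong (x +_) (sumList-++ xs ys)) (sym (+-assoc x _ _))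

sumList-↭ : ∀ {xs ys} → xs ↭ ys → sumList xs ≡ sumList ys
sumList-↭ _↭_.refl = refl
sumList-↭ (prep x p) = cong (x +_) (sumList-↭ p)
sumList-↭ {x ∷ y ∷ xs} {_ ∷ _ ∷ ys} (swap _ _ p) = begin
  x + (y + sumList xs) ≡⟨ +-assoc x y _ ⟨
  x + y + sumList xs   ≡⟨ cong₂ _+_ (+-comm x y) (sumList-↭ p) ⟩
  y + x + sumList ys   ≡⟨ +-assoc y x _ ⟩
  y + (x + sumList ys) ∎
  where open ≡-Reasoning
sumList-↭ (_↭_.trans p q) = trans (sumList-↭ p) (sumList-↭ q)


∑-++ : ∀ (f : A → ℕ) xs ys → ∑ f (xs ++ ys) ≡ ∑ f xs + ∑ f ys
∑-++ f xs ys = trans (cong sumList (map-++ f xs ys)) (sumList-++ (map f xs) (map f ys))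

∑-↭ : ∀ (f : A → ℕ) {xs ys} → xs ↭ ys → ∑ f xs ≡ ∑ f ys
∑-↭ f p = sumList-↭ (↭.map⁺ f p)

∑-cong : ∀ {f g : A → ℕ} xs → (∀ {x} → x ∈ xs → f x ≡ g x) → ∑ f xs ≡ ∑ g xs
∑-cong xs f≡g = cong sumList (map-cong-local (All.tabulate f≡g))

∑-+ : ∀ (f g : A → ℕ) xs → ∑ (λ x → f x + g x) xs ≡ ∑ f xs + ∑ g xs
∑-+ f g []       = refl
∑-+ f g (x ∷ xs) rewrite ∑-+ f g xs = solve 4
  (λ a b c e → (a :+ b) :+ (c :+ e) := (a :+ c) :+ (b :+ e)) refl (f x) (g x) (∑ f xs) (∑ g xs)

∑-*ˡ : ∀ c (f : A → ℕ) xs → ∑ (λ x → c * f x) xs ≡ c * ∑ f xs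
∑-*ˡ c f []       = sym (*-zeroʳ c)
∑-*ˡ c f (x ∷ xs) = trans (cong (c * f x +_) (∑-*ˡ c f xs)) (sym (*-distribˡ-+ c (f x) _))

∑-const : ∀ c (xs : List A) → ∑ (λ _ → c) xs ≡ c * length xs
∑-const c []       = sym (*-zeroʳ c)
∑-const c (x ∷ xs) = trans (cong (c +_) (∑-const c xs)) (sym (*-suc c (length xs)))

∑-concatMap : ∀ (f : B → ℕ) (h : A → List B) xs → ∑ f (concatMap h xs) ≡ ∑ (λ x → ∑ f (h x)) xs
∑-concatMap f h []       = refl
∑-concatMap f h (x ∷ xs) = trans (∑-++ f (h x) (concatMap h xs)) (cong (∑ f (h x) +_) (∑-concatMap f h xs))

∑-map : ∀ (f : B → ℕ) (g : A → B) xs → ∑ f (map g xs) ≡ ∑ (λ x → f (g x)) xs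
∑-map f g xs = cong sumList (sym (map-∘ xs))

∑-upTo-suc : ∀ (f : ℕ → ℕ) n → ∑ f (upTo (suc n)) ≡ f 0 + ∑ (λ x → f (suc x)) (upTo n)
∑-upTo-suc f n = cong (λ xs → f 0 + sumList xs) (trans (map-applyUpTo suc f n) (sym (map-upTo (λ x → f (suc x)) n)))

∑-upTo-snoc : ∀ (f : ℕ → ℕ) n → ∑ f (upTo (suc n)) ≡ ∑ f (upTo n) + f n
∑-upTo-snoc f n = trans (cong (∑ f) (sym (upTo-∷ʳ n)))
  (trans (∑-++ f (upTo n) [ n ]) (cong (∑ f (upTo n) +_) (+-identityʳ (f n))))

∑-upTo-cong : ∀ {f g : ℕ → ℕ} n → (∀ {i} → i < n → f i ≡ g i) → ∑ f (upTo n) ≡ ∑ g (upTo n)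
∑-upTo-cong n f≡g = ∑-cong (upTo n) (f≡g ∘′ ∈-upTo⁻)

length-concatMap : ∀ (h : A → List B) xs → length (concatMap h xs) ≡ ∑ (λ x → length (h x)) xs
length-concatMap h []       = refl
length-concatMap h (x ∷ xs) = trans (length-++ (h x)) (cong (length (h x) +_) (length-concatMap h xs))

setAt : ℕ → ℕ → List ℕ → List ℕ
setAt k       v []       = []
setAt zero    v (x ∷ xs) = v ∷ xs
setAt (suc k) v (x ∷ xs) = x ∷ setAt k v xs

length-setAt : ∀ k v xs → length (setAt k v xs) ≡ length xs
length-setAt k       v []       = refl
length-setAt zero    v (x ∷ xs) = refl
length-setAt (suc k) v (x ∷ xs) = cong suc (length-setAt k v xs)

nth-setAt≡ : ∀ k v xs → k < length xs → nth (setAt k v xs) k ≡ v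
nth-setAt≡ zero    v (x ∷ xs) _       = refl
nth-setAt≡ (suc k) v (x ∷ xs) (s≤s k<) = nth-setAt≡ k v xs k<

nth-setAt≢ : ∀ k v xs i → i ≢ k → nth (setAt k v xs) i ≡ nth xs i
nth-setAt≢ k       v []       i       _   = refl
nth-setAt≢ zero    v (x ∷ xs) zero    i≢k = ⊥-elim (i≢k refl)
nth-setAt≢ zero    v (x ∷ xs) (suc i) _   = refl
nth-setAt≢ (suc k) v (x ∷ xs) zero    _   = refl
nth-setAt≢ (suc k) v (x ∷ xs) (suc i) i≢k = nth-setAt≢ k v xs i (i≢k ∘′ cong suc)

setAt-middle : ∀ xs u v ys → setAt (length xs) v (xs ++ u ∷ ys) ≡ xs ++ v ∷ ys
setAt-middle []       u v ys = refl
setAt-middle (x ∷ xs) u v ys = cong (x ∷_) (setAt-middle xs u v ys)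

setAt-injective : ∀ k v xs ys → setAt k v xs ≡ setAt k v ys → nth xs k ≡ nth ys k →
                  length xs ≡ length ys → xs ≡ ys
setAt-injective k       v []       []       _ _ _ = refl
setAt-injective zero    v (x ∷ xs) (y ∷ ys) e x≡y _ = cong₂ _∷_ x≡y (proj₂ (∷-injective e))
setAt-injective (suc k) v (x ∷ xs) (y ∷ ys) e eₖ eₗ =
  cong₂ _∷_ (proj₁ (∷-injective e)) (setAt-injective k v xs ys (proj₂ (∷-injective e)) eₖ (suc-injective eₗ))

setAt-↭ : ∀ k v xs → k < length xs → setAt k v xs ++ [ nth xs k ] ↭ xs ++ [ v ]
setAt-↭ zero v (x ∷ xs) _ =
  ↭-trans (prep v (↭-sym (∷↭∷ʳ x xs))) (↭-trans (swap v x ↭-refl) (prep x (∷↭∷ʳ v xs)))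
setAt-↭ (suc k) v (x ∷ xs) (s≤s k<) = prep x (setAt-↭ k v xs k<)

nth-++ˡ : ∀ xs ys i → i < length xs → nth (xs ++ ys) i ≡ nth xs i
nth-++ˡ (x ∷ xs) ys zero    _        = refl
nth-++ˡ (x ∷ xs) ys (suc i) (s≤s i<) = nth-++ˡ xs ys i i<

nth-length : ∀ xs v ys → nth (xs ++ v ∷ ys) (length xs) ≡ v
nth-length []       v ys = refl
nth-length (x ∷ xs) v ys = nth-length xs v ys

nth-∈ : ∀ xs i → i < length xs → nth xs i ∈ xs
nth-∈ (x ∷ xs) zero    _        = here refl
nth-∈ (x ∷ xs) (suc i) (s≤s i<) = there (nth-∈ xs i i<)

insertAfter : ℕ → ℕ → List ℕ → List ℕ
insertAfter x v []       = []
insertAfter x v (y ∷ ys) = if y ≡ᵇ x then y ∷ v ∷ insertAfter x v ys else y ∷ insertAfter x v ys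

insertAfter-here : ∀ x v ys → insertAfter x v (x ∷ ys) ≡ x ∷ v ∷ insertAfter x v ys
insertAfter-here x v ys rewrite ≡ᵇ-true x x refl = refl

insertAfter-there : ∀ x v y ys → y ≢ x → insertAfter x v (y ∷ ys) ≡ y ∷ insertAfter x v ys
insertAfter-there x v y ys y≢x rewrite ≡ᵇ-false y x y≢x = refl

insertAfter-++ : ∀ x v xs ys → insertAfter x v (xs ++ ys) ≡ insertAfter x v xs ++ insertAfter x v ys
insertAfter-++ x v []       ys = refl
insertAfter-++ x v (y ∷ xs) ys with y ≟ x
... | yes refl rewrite insertAfter-here y v (xs ++ ys) | insertAfter-here y v xs =
  cong (λ zs → y ∷ v ∷ zs) (insertAfter-++ x v xs ys)
... | no y≢x rewrite insertAfter-there x v y (xs ++ ys) y≢x | insertAfter-there x v y xs y≢x =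
  cong (y ∷_) (insertAfter-++ x v xs ys)

insertAfter-∉ : ∀ x v ys → x ∉ ys → insertAfter x v ys ≡ ys
insertAfter-∉ x v []       _  = refl
insertAfter-∉ x v (y ∷ ys) x∉ with y ≟ x
... | yes refl = ⊥-elim (x∉ (here refl))
... | no y≢x rewrite insertAfter-there x v y ys y≢x = cong (y ∷_) (insertAfter-∉ x v ys (x∉ ∘′ there))

All-insertAfter : ∀ {P : ℕ → Set} x v ys → All P ys → P v → All P (insertAfter x v ys)
All-insertAfter x v []       []         pv = []
All-insertAfter x v (y ∷ ys) (py ∷ pys) pv with y ≟ x
... | yes refl rewrite insertAfter-here y v ys = py ∷ pv ∷ All-insertAfter x v ys pys pv
... | no y≢x rewrite insertAfter-there x v y ys y≢x = py ∷ All-insertAfter x v ys pys pv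

∈-insertAfter : ∀ x v ys → x ∈ ys → v ∈ insertAfter x v ys
∈-insertAfter x v (y ∷ ys) x∈ with y ≟ x | x∈
... | yes refl | _         rewrite insertAfter-here y v ys = there (here refl)
... | no y≢x   | here refl = ⊥-elim (y≢x refl)
... | no y≢x   | there x∈′ rewrite insertAfter-there x v y ys y≢x = there (∈-insertAfter x v ys x∈′)

insertAfter-↭ : ∀ x v ys → x ∈ ys → Unique ys → insertAfter x v ys ↭ ys ++ [ v ]
insertAfter-↭ x v (y ∷ ys) (here refl) (y∉ ∷ _)
  rewrite insertAfter-here y v ys | insertAfter-∉ y v ys (λ y∈ → All.lookup y∉ y∈ refl) = prep y (∷↭∷ʳ v ys)
insertAfter-↭ x v (y ∷ ys) (there x∈) (y∉ ∷ u)
  rewrite insertAfter-there x v y ys (All.lookup y∉ x∈) = prep y (insertAfter-↭ x v ys x∈ u)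

elemᵇ⇒∈ : ∀ a ys → elemᵇ a ys ≡ true → a ∈ ys
elemᵇ⇒∈ a (y ∷ ys) e with a ≟ y
... | yes refl = here refl
... | no a≢y rewrite ≡ᵇ-false a y a≢y = there (elemᵇ⇒∈ a ys e)

∈⇒elemᵇ : ∀ a ys → a ∈ ys → elemᵇ a ys ≡ true
∈⇒elemᵇ a (y ∷ ys) (here refl) rewrite ≡ᵇ-true a a refl = refl
∈⇒elemᵇ a (y ∷ ys) (there a∈) rewrite ∈⇒elemᵇ a ys a∈ = ∨-zeroʳ (a ≡ᵇ y)

∉⇒elemᵇ : ∀ a ys → a ∉ ys → elemᵇ a ys ≡ false
∉⇒elemᵇ a ys a∉ with elemᵇ a ys in eq
... | true  = ⊥-elim (a∉ (elemᵇ⇒∈ a ys eq))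
... | false = refl

elemᵇ-insertAfter : ∀ a x v ys → a ≢ v → elemᵇ a (insertAfter x v ys) ≡ elemᵇ a ys
elemᵇ-insertAfter a x v []       _   = refl
elemᵇ-insertAfter a x v (y ∷ ys) a≢v with y ≟ x
... | yes refl rewrite insertAfter-here y v ys | ≡ᵇ-false a v a≢v =
  cong ((a ≡ᵇ y) ∨_) (elemᵇ-insertAfter a y v ys a≢v)
... | no y≢x rewrite insertAfter-there x v y ys y≢x =
  cong ((a ≡ᵇ y) ∨_) (elemᵇ-insertAfter a x v ys a≢v)

-- Flattening a permutation given by its one-line word

data IsOrbit (f : ℕ → ℕ) (a : ℕ) : ℕ → List ℕ → Set where
  last : ∀ {x}   → f x ≡ a → IsOrbit f a x [ x ]
  _∷_  : ∀ {x c} → f x ≢ a → IsOrbit f a (f x) c → IsOrbit f a x (x ∷ c)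

IsOrbit⇒orbit≡ : ∀ {f a x c} k → IsOrbit f a x c → length c ≤ k → orbit k f a x ≡ c
IsOrbit⇒orbit≡ {f} {a} {x} (suc k) (last fx≡a) _ rewrite ≡ᵇ-true (f x) a fx≡a = refl
IsOrbit⇒orbit≡ {f} {a} {x} (suc k) (fx≢a ∷ o) (s≤s c≤k)
  rewrite ≡ᵇ-false (f x) a fx≢a = cong (x ∷_) (IsOrbit⇒orbit≡ k o c≤k)

IsOrbit-cong : ∀ {f g a x c} → (∀ y → y ∈ c → g y ≡ f y) → IsOrbit f a x c → IsOrbit g a x c
IsOrbit-cong {x = x} g≡f (last fx≡a) = last (trans (g≡f x (here refl)) fx≡a)
IsOrbit-cong {g = g} {a} {x} g≡f (fx≢a ∷ o) =
  (λ gx≡a → fx≢a (trans (sym (g≡f x (here refl))) gx≡a)) ∷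
  subst (λ z → IsOrbit g a z _) (sym (g≡f x (here refl))) (IsOrbit-cong (λ y y∈ → g≡f y (there y∈)) o)

IsOrbit-insertAfter : ∀ {f g a y c} x v → a ≢ v → g x ≡ v → g v ≡ f x →
  (∀ z → z ∈ c → z ≢ x → g z ≡ f z) → IsOrbit f a y c → IsOrbit g a y (insertAfter x v c)
IsOrbit-insertAfter {f} {g} {a} {y} {c} x v a≢v gx≡v gv≡fx g≡f o with y ≟ x | o
... | yes refl | last fy≡a rewrite insertAfter-here y v [] =
  gy≢a ∷ subst (λ z → IsOrbit g a z [ v ]) (sym gx≡v) (last (trans gv≡fx fy≡a))
  where gy≢a = λ gy≡a → a≢v (trans (sym gy≡a) gx≡v)
... | yes refl | _∷_ {c = c′} fy≢a o′ rewrite insertAfter-here y v c′ =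
  gy≢a ∷ subst (λ z → IsOrbit g a z (v ∷ insertAfter y v c′)) (sym gx≡v)
    ((λ gv≡a → fy≢a (trans (sym gv≡fx) gv≡a)) ∷
     subst (λ z → IsOrbit g a z (insertAfter y v c′)) (sym gv≡fx)
       (IsOrbit-insertAfter y v a≢v gx≡v gv≡fx (λ z z∈ → g≡f z (there z∈)) o′))
  where gy≢a = λ gy≡a → a≢v (trans (sym gy≡a) gx≡v)
... | no y≢x | last fy≡a rewrite insertAfter-there x v y [] y≢x =
  last (trans (g≡f y (here refl) y≢x) fy≡a)
... | no y≢x | _∷_ {c = c′} fy≢a o′ rewrite insertAfter-there x v y c′ y≢x =
  (λ gy≡a → fy≢a (trans (sym gy≡fy) gy≡a)) ∷
  subst (λ z → IsOrbit g a z (insertAfter x v c′)) (sym gy≡fy)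
    (IsOrbit-insertAfter x v a≢v gx≡v gv≡fx (λ z z∈ → g≡f z (there z∈)) o′)
  where gy≡fy = g≡f y (here refl) y≢x

-- A fuel-free description of flattenGo, which can be transported along the insertion of n+1.
data FlattenRun (f : ℕ → ℕ) (n : ℕ) : List ℕ → List ℕ → List ℕ → Set where
  done     : ∀ {acc} → FlattenRun f n [] acc acc
  seen     : ∀ {a as acc out} → elemᵇ a acc ≡ true →
             FlattenRun f n as acc out → FlattenRun f n (a ∷ as) acc out
  newCycle : ∀ {a as acc out c} → elemᵇ a acc ≡ false → IsOrbit f a a c → All (InRange n) c →
             FlattenRun f n as (acc ++ c) out → FlattenRun f n (a ∷ as) acc out

FlattenRun-extends : ∀ {f n as acc out} → FlattenRun f n as acc out → ∃ λ r → out ≡ acc ++ r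
FlattenRun-extends {acc = acc} done = [] , sym (++-identityʳ acc)
FlattenRun-extends (seen _ r) = FlattenRun-extends r
FlattenRun-extends {acc = acc} (newCycle {c = c} _ _ _ r) with FlattenRun-extends r
... | t , out≡ = c ++ t , trans out≡ (++-assoc acc c t)

FlattenRun⇒flattenGo≡ : ∀ {w n as acc out} → FlattenRun (app w) n as acc out →
  length out ≤ length w → flattenGo w as acc ≡ out
FlattenRun⇒flattenGo≡ done _ = refl
FlattenRun⇒flattenGo≡ {w} (seen a∈acc r) out≤w rewrite a∈acc = FlattenRun⇒flattenGo≡ {w} r out≤w
FlattenRun⇒flattenGo≡ {w} {acc = acc} {out} (newCycle {as = as} {c = c} a∉acc o _ r) out≤w
  rewrite a∉acc with FlattenRun-extends r
... | t , out≡ =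
  trans (cong (λ z → flattenGo w as (acc ++ z)) (IsOrbit⇒orbit≡ (length w) o c≤w))
        (FlattenRun⇒flattenGo≡ {w} r out≤w)
  where
  open ≤-Reasoning
  c≤w : length c ≤ length w
  c≤w = begin
    length c                  ≤⟨ m≤n+m (length c) (length acc) ⟩
    length acc + length c     ≡⟨ length-++ acc ⟨
    length (acc ++ c)         ≤⟨ m≤m+n _ (length t) ⟩
    length (acc ++ c) + length t ≡⟨ trans (cong length out≡) (length-++ (acc ++ c)) ⟨
    length out                ≤⟨ out≤w ⟩
    length w                  ∎

FlattenRun-++ : ∀ {f n as bs acc out out′} → FlattenRun f n as acc out → FlattenRun f n bs out out′ →
  FlattenRun f n (as ++ bs) acc out′
FlattenRun-++ done r′ = r′
FlattenRun-++ (seen e r) r′ = seen e (FlattenRun-++ r r′)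
FlattenRun-++ (newCycle e o c∈ r) r′ = newCycle e o c∈ (FlattenRun-++ r r′)

FlattenRun-extend : ∀ {f g n as acc out} → (∀ y → InRange n y → g y ≡ f y) →
  FlattenRun f n as acc out → FlattenRun g (suc n) as acc out
FlattenRun-extend g≡f done = done
FlattenRun-extend g≡f (seen e r) = seen e (FlattenRun-extend g≡f r)
FlattenRun-extend g≡f (newCycle e o c∈ r) =
  newCycle e (IsOrbit-cong (λ y y∈ → g≡f y (All.lookup c∈ y∈)) o) (All.map InRange-suc c∈)
    (FlattenRun-extend g≡f r)

FlattenRun-insertAfter : ∀ {f g n as acc out} x → g x ≡ suc n → g (suc n) ≡ f x →
  (∀ y → InRange n y → y ≢ x → g y ≡ f y) → All (InRange n) as → FlattenRun f n as acc out →
  FlattenRun g (suc n) as (insertAfter x (suc n) acc) (insertAfter x (suc n) out)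
FlattenRun-insertAfter x gx gn g≡f [] done = done
FlattenRun-insertAfter {acc = acc} x gx gn g≡f (a∈ ∷ as∈) (seen {a = a} e r) =
  seen (trans (elemᵇ-insertAfter a x _ acc (InRange⇒≢suc a∈)) e)
       (FlattenRun-insertAfter x gx gn g≡f as∈ r)
FlattenRun-insertAfter {n = n} {acc = acc} x gx gn g≡f (a∈ ∷ as∈) (newCycle {a = a} {c = c} e o c∈ r) =
  newCycle (trans (elemᵇ-insertAfter a x _ acc (InRange⇒≢suc a∈)) e)
    (IsOrbit-insertAfter x (suc n) (InRange⇒≢suc a∈) gx gn (λ z z∈ → g≡f z (All.lookup c∈ z∈)) o)
    (All-insertAfter x (suc n) c (All.map InRange-suc c∈) (s≤s z≤n , ≤-refl))
    (subst (λ z → FlattenRun _ (suc n) _ z _) (insertAfter-++ x (suc n) acc c)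
      (FlattenRun-insertAfter x gx gn g≡f as∈ r))

-- All permutations, by inserting the largest element

-- On one-line words of permutations of [n]: insertMax n w 0 adds n+1 as a fixed point, and
-- insertMax n w (k+1) puts n+1 right after k+1 on its cycle, i.e. σ(k+1) := n+1, σ(n+1) := σ(k+1).
insertMax : ℕ → List ℕ → ℕ → List ℕ
insertMax n w zero    = w ++ [ suc n ]
insertMax n w (suc k) = setAt k (suc n) w ++ [ nth w k ]

flatInsertMax : ℕ → List ℕ → ℕ → List ℕ
flatInsertMax n s zero    = s ++ [ suc n ]
flatInsertMax n s (suc k) = insertAfter (suc k) (suc n) s

allPerms : ℕ → List (List ℕ)
allPerms zero    = [ [] ]
allPerms (suc n) = concatMap (λ w → map (insertMax n w) (upTo (suc n))) (allPerms n)

module _ (n : ℕ) (w : List ℕ) (w≡n : length w ≡ n) where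

  app-insertMax₀-old : ∀ y → InRange n y → app (insertMax n w 0) y ≡ app w y
  app-insertMax₀-old y y∈ = nth-++ˡ w _ (y ∸ 1) (subst (y ∸ 1 <_) (sym w≡n) (InRange⇒pred< y∈))

  app-insertMax₀-new : app (insertMax n w 0) (suc n) ≡ suc n
  app-insertMax₀-new = subst (λ i → nth (w ++ [ suc n ]) i ≡ suc n) w≡n (nth-length w (suc n) [])

  module _ (k : ℕ) (k<n : k < n) where
    private
      w′ = setAt k (suc n) w
      k<w = subst (k <_) (sym w≡n) k<n
      w′≡n : length w′ ≡ n
      w′≡n = trans (length-setAt k (suc n) w) w≡n

    app-insertMax-old : ∀ y → InRange n y → y ≢ suc k → app (insertMax n w (suc k)) y ≡ app w y
    app-insertMax-old (suc y) y∈ y≢k =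
      trans (nth-++ˡ w′ _ y (subst (y <_) (sym w′≡n) (InRange⇒pred< y∈)))
            (nth-setAt≢ k (suc n) w y (y≢k ∘′ cong suc))

    app-insertMax-pred : app (insertMax n w (suc k)) (suc k) ≡ suc n
    app-insertMax-pred = trans (nth-++ˡ w′ _ k (subst (k <_) (sym w′≡n) k<n)) (nth-setAt≡ k (suc n) w k<w)

    app-insertMax-new : app (insertMax n w (suc k)) (suc n) ≡ app w (suc k)
    app-insertMax-new = subst (λ i → nth (w′ ++ [ nth w k ]) i ≡ nth w k) w′≡n (nth-length w′ (nth w k) [])

    insertMax-↭ : w ↭ range1 n → insertMax n w (suc k) ↭ range1 (suc n)
    insertMax-↭ w↭ = subst (insertMax n w (suc k) ↭_) (sym (range1-suc n))
      (↭-trans (setAt-↭ k (suc n) w k<w) (++⁺ʳ [ suc n ] w↭))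

record Flattens (n : ℕ) (w s : List ℕ) : Set where
  field
    perm        : w ↭ range1 n
    run         : FlattenRun (app w) n (range1 n) [] s
    flatPerm    : s ↭ range1 n
    startsWith1 : n ≡ 0 ⊎ ∃ λ t → s ≡ 1 ∷ t
open Flattens

Flattens-[] : Flattens 0 [] []
Flattens-[] = record { perm = ↭-refl ; run = done ; flatPerm = ↭-refl ; startsWith1 = inj₁ refl }

Flattens⇒Flatten≡ : ∀ {n w s} → Flattens n w s → Flatten w ≡ s
Flattens⇒Flatten≡ {n} {w} F =
  trans (cong (λ m → flattenGo w (range1 m) []) (length-↭-range1 (perm F)))
        (FlattenRun⇒flattenGo≡ {w} (run F)
          (≤-reflexive (trans (length-↭-range1 (flatPerm F)) (sym (length-↭-range1 (perm F))))))

Flattens-startsWith1 : ∀ {n w s} → 1 ≤ n → Flattens n w s → ∃ λ t → s ≡ 1 ∷ t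
Flattens-startsWith1 1≤n F with startsWith1 F
... | inj₁ refl = ⊥-elim (1+n≰n 1≤n)
... | inj₂ s≡  = s≡

Flattens-insertFixed : ∀ {n w s} → Flattens n w s → Flattens (suc n) (insertMax n w 0) (s ++ [ suc n ])
Flattens-insertFixed {n} {w} {s} F = record
  { perm = subst (w ++ [ suc n ] ↭_) (sym (range1-suc n)) (++⁺ʳ [ suc n ] (perm F))
  ; run = subst (λ as → FlattenRun (app (insertMax n w 0)) (suc n) as [] (s ++ [ suc n ])) (sym (range1-suc n))
      (FlattenRun-++ (FlattenRun-extend (app-insertMax₀-old n w w≡n) (run F))
        (newCycle (∉⇒elemᵇ (suc n) s n+1∉s) (last (app-insertMax₀-new n w w≡n)) ((s≤s z≤n , ≤-refl) ∷ []) done))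
  ; flatPerm = subst (s ++ [ suc n ] ↭_) (sym (range1-suc n)) (++⁺ʳ [ suc n ] (flatPerm F))
  ; startsWith1 = inj₂ (starts (startsWith1 F))
  }
  where
  w≡n = length-↭-range1 (perm F)
  n+1∉s : suc n ∉ s
  n+1∉s n+1∈s = InRange⇒≢suc (∈-range1⁻ n (∈-resp-↭ (flatPerm F) n+1∈s)) refl
  starts : n ≡ 0 ⊎ (∃ λ t → s ≡ 1 ∷ t) → ∃ λ t → s ++ [ suc n ] ≡ 1 ∷ t
  starts (inj₂ (t , refl)) = t ++ [ suc n ] , refl
  starts (inj₁ refl) rewrite ↭-empty-inv (flatPerm F) = [] , refl

Flattens-insertAfter : ∀ {n w s} k → k < n → Flattens n w s →
  Flattens (suc n) (insertMax n w (suc k)) (insertAfter (suc k) (suc n) s)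
Flattens-insertAfter {n} {w} {s} k k<n F = record
  { perm = insertMax-↭ n w w≡n k k<n (perm F)
  ; run = subst (λ as → FlattenRun (app (insertMax n w (suc k))) (suc n) as [] s′) (sym (range1-suc n))
      (FlattenRun-++
        (FlattenRun-insertAfter (suc k) (app-insertMax-pred n w w≡n k k<n) (app-insertMax-new n w w≡n k k<n)
          (app-insertMax-old n w w≡n k k<n) (All-InRange-range1 n) (run F))
        (seen (∈⇒elemᵇ (suc n) s′ (∈-insertAfter (suc k) (suc n) s k+1∈s)) done))
  ; flatPerm = subst (s′ ↭_) (sym (range1-suc n))
      (↭-trans (insertAfter-↭ (suc k) (suc n) s k+1∈s (Unique-resp-↭ (↭-sym (flatPerm F)) (range1-unique n)))
               (++⁺ʳ [ suc n ] (flatPerm F)))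
  ; startsWith1 = inj₂ (starts k (Flattens-startsWith1 (≤-trans (s≤s z≤n) k<n) F))
  }
  where
  w≡n = length-↭-range1 (perm F)
  s′ = insertAfter (suc k) (suc n) s
  k+1∈s : suc k ∈ s
  k+1∈s = ∈-resp-↭ (↭-sym (flatPerm F)) (∈-range1⁺ n (s≤s z≤n , k<n))
  starts : ∀ j → (∃ λ t → s ≡ 1 ∷ t) → ∃ λ t → insertAfter (suc j) (suc n) s ≡ 1 ∷ t
  starts zero    (t , refl) rewrite insertAfter-here 1 (suc n) t = _ , refl
  starts (suc j) (t , refl) rewrite insertAfter-there (2 + j) (suc n) 1 t (λ ()) = _ , refl

Flattens-insertMax : ∀ {n w s} x → x ≤ n → Flattens n w s →
  Flattens (suc n) (insertMax n w x) (flatInsertMax n s x)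
Flattens-insertMax zero    _   = Flattens-insertFixed
Flattens-insertMax (suc k) k<n = Flattens-insertAfter k k<n

allPerms-flatten : ∀ n → All (λ w → ∃ (Flattens n w)) (allPerms n)
allPerms-flatten zero    = ([] , Flattens-[]) ∷ []
allPerms-flatten (suc n) = All.concat⁺ (All.map⁺ (All.map
  (λ { {w} (s , F) → All.map⁺ (All.tabulate λ {x} x∈ →
         flatInsertMax n s x , Flattens-insertMax x (≤-pred (∈-upTo⁻ x∈)) F) })
  (allPerms-flatten n)))

∈-allPerms⇒↭ : ∀ n {σ} → σ ∈ allPerms n → σ ↭ range1 n
∈-allPerms⇒↭ n σ∈ = perm (proj₂ (All.lookup (allPerms-flatten n) σ∈))

nth∈range1 : ∀ n {w} → w ↭ range1 n → ∀ k → k < n → InRange n (nth w k)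
nth∈range1 n w↭ k k<n = ∈-range1⁻ n (∈-resp-↭ w↭ (nth-∈ _ k (subst (k <_) (sym (length-↭-range1 w↭)) k<n)))

insertMax-injective : ∀ n {w w′ x x′} → w ↭ range1 n → w′ ↭ range1 n → x ≤ n → x′ ≤ n →
  insertMax n w x ≡ insertMax n w′ x′ → w ≡ w′ × x ≡ x′
insertMax-injective n {w} {w′} {zero} {zero} _ _ _ _ e = proj₁ (∷ʳ-injective w w′ e) , refl
insertMax-injective n {w} {w′} {zero} {suc k′} _ w′↭ _ k′<n e =
  ⊥-elim (InRange⇒≢suc (nth∈range1 n w′↭ k′ k′<n) (sym (proj₂ (∷ʳ-injective w _ e))))
insertMax-injective n {w} {w′} {suc k} {zero} w↭ _ k<n _ e =
  ⊥-elim (InRange⇒≢suc (nth∈range1 n w↭ k k<n) (proj₂ (∷ʳ-injective _ w′ e)))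
insertMax-injective n {w} {w′} {suc k} {suc k′} w↭ w′↭ k<n k′<n e
  with ∷ʳ-injective (setAt k (suc n) w) (setAt k′ (suc n) w′) e | k ≟ k′
... | e₁ , e₂ | yes refl =
  setAt-injective k (suc n) w w′ e₁ e₂ (trans (length-↭-range1 w↭) (sym (length-↭-range1 w′↭))) , refl
... | e₁ , e₂ | no k≢k′ = ⊥-elim (InRange⇒≢suc (nth∈range1 n w′↭ k k<n) (begin
  nth w′ k                    ≡⟨ nth-setAt≢ k′ (suc n) w′ k k≢k′ ⟨
  nth (setAt k′ (suc n) w′) k ≡⟨ cong (λ v → nth v k) e₁ ⟨
  nth (setAt k (suc n) w) k   ≡⟨ nth-setAt≡ k (suc n) w (subst (k <_) (sym (length-↭-range1 w↭)) k<n) ⟩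
  suc n                       ∎))
  where open ≡-Reasoning

allPerms-unique : ∀ n → Unique (allPerms n)
allPerms-unique zero    = [] ∷ []
allPerms-unique (suc n) =
  Unique-concatMap-map (insertMax n) (allPerms n) (upTo (suc n)) (allPerms-unique n) (Unique.upTo⁺ (suc n))
    (λ w∈ w′∈ x∈ x′∈ → insertMax-injective n (∈-allPerms⇒↭ n w∈) (∈-allPerms⇒↭ n w′∈)
                         (≤-pred (∈-upTo⁻ x∈)) (≤-pred (∈-upTo⁻ x′∈)))

insertMax∈allPerms : ∀ n {w} x → w ∈ allPerms n → x ≤ n → insertMax n w x ∈ allPerms (suc n)
insertMax∈allPerms n x w∈ x≤n =
  ∈-concat⁺′ (∈-map⁺ (insertMax n _) (∈-upTo⁺ (s≤s x≤n))) (∈-map⁺ (λ w → map (insertMax n w) (upTo (suc n))) w∈)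

↭⇒∈-allPerms : ∀ n {σ} → σ ↭ range1 n → σ ∈ allPerms n
↭⇒∈-allPerms zero σ↭ rewrite ↭-empty-inv σ↭ = here refl
↭⇒∈-allPerms (suc n) {σ} σ↭ with initLast σ
... | [] = ⊥-elim (0≢1+n (length-↭-range1 σ↭))
... | ini ∷ʳ′ y with y ≟ suc n
...   | yes refl = insertMax∈allPerms n 0 (↭⇒∈-allPerms n ini↭) z≤n
  where
  ini↭ : ini ↭ range1 n
  ini↭ = subst₂ _↭_ (++-identityʳ ini) (++-identityʳ (range1 n))
           (drop-mid ini (range1 n) {[]} {[]} (subst (ini ++ [ suc n ] ↭_) (range1-suc n) σ↭))
...   | no y≢n+1 with ∈-∃++ n+1∈ini
  where
  n+1∈ini : suc n ∈ ini
  n+1∈ini with ∈-++⁻ ini (∈-resp-↭ (↭-sym σ↭) (∈-range1⁺ (suc n) (s≤s z≤n , ≤-refl)))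
  ... | inj₁ n+1∈   = n+1∈
  ... | inj₂ (here n+1≡y) = ⊥-elim (y≢n+1 (sym n+1≡y))
-- σ = (as ++ n+1 ∷ bs) ++ [ y ] comes from w by putting n+1 right after |as|+1.
...     | as , bs , refl = subst (_∈ allPerms (suc n)) σ≡ (insertMax∈allPerms n (suc (length as)) (↭⇒∈-allPerms n w↭) k<n)
  where
  w : List ℕ
  w = as ++ y ∷ bs
  w↭ : w ↭ range1 n
  w↭ = ↭-trans (++⁺ˡ as (∷↭∷ʳ y bs))
         (subst (as ++ bs ++ [ y ] ↭_) (++-identityʳ (range1 n))
           (drop-mid as (range1 n) (subst₂ _↭_ (++-assoc as (suc n ∷ bs) [ y ]) (range1-suc n) σ↭)))
  k<n : suc (length as) ≤ n
  k<n = subst (length as <_) (trans (sym (length-++ as)) (length-↭-range1 w↭)) (m<m+n (length as) (s≤s z≤n))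
  σ≡ : insertMax n w (suc (length as)) ≡ (as ++ suc n ∷ bs) ++ [ y ]
  σ≡ = cong₂ (λ u v → u ++ [ v ]) (setAt-middle as y (suc n) bs) (nth-length as y bs)

allPerms↭ : ∀ n (perms : List (List ℕ)) → Unique perms → (∀ σ → (σ ∈ perms) ⇔ (σ ↭ range1 n)) →
  perms ↭ allPerms n
allPerms↭ n perms u ∈perms⇔ = ∼bag⇒↭ (unique∧set⇒bag u (allPerms-unique n) λ {σ} →
  mk⇔ (↭⇒∈-allPerms n ∘′ Equivalence.to (∈perms⇔ σ)) (Equivalence.from (∈perms⇔ σ) ∘′ ∈-allPerms⇒↭ n))

𝟙[_≡_] : ℕ → ℕ → ℕ
𝟙[ k ≡ m ] = if k ≡ᵇ m then 1 else 0

𝟙-≢ : ∀ {k m} → k ≢ m → 𝟙[ k ≡ m ] ≡ 0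
𝟙-≢ {k} {m} k≢m rewrite ≡ᵇ-false k m k≢m = refl

𝟙-subst : ∀ k m (g : ℕ → ℕ) → 𝟙[ k ≡ m ] * g k ≡ g m * 𝟙[ k ≡ m ]
𝟙-subst k m g with k ≟ m
... | yes refl = *-comm 𝟙[ k ≡ k ] (g k)
... | no k≢m rewrite 𝟙-≢ k≢m = sym (*-zeroʳ (g m))

∑-𝟙-subst : ∀ (D : A → ℕ) (g : ℕ → ℕ) m xs →
  ∑ (λ x → 𝟙[ D x ≡ m ] * g (D x)) xs ≡ g m * ∑ (λ x → 𝟙[ D x ≡ m ]) xs
∑-𝟙-subst D g m xs = trans (∑-cong xs (λ {x} _ → 𝟙-subst (D x) m g)) (∑-*ˡ (g m) (λ x → 𝟙[ D x ≡ m ]) xs)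

countFlat≡∑ : ∀ d m σs → countFlat d m σs ≡ ∑ (λ σ → 𝟙[ flatDesc d σ ≡ m ]) σs
countFlat≡∑ d m []       = refl
countFlat≡∑ d m (σ ∷ σs) = cong (𝟙[ flatDesc d σ ≡ m ] +_) (countFlat≡∑ d m σs)

countFlat-↭ : ∀ d m {σs τs} → σs ↭ τs → countFlat d m σs ≡ countFlat d m τs
countFlat-↭ d m {σs} {τs} p =
  trans (countFlat≡∑ d m σs) (trans (∑-↭ _ p) (sym (countFlat≡∑ d m τs)))

-- Descents after inserting the largest element

insertEverywhere : ℕ → List ℕ → List (List ℕ)
insertEverywhere v []       = []
insertEverywhere v (y ∷ ys) = (y ∷ v ∷ ys) ∷ map (y ∷_) (insertEverywhere v ys)

map-insertAfter : ∀ v s → Unique s → map (λ y → insertAfter y v s) s ≡ insertEverywhere v s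
map-insertAfter v []       _ = refl
map-insertAfter v (y ∷ ys) (y∉ ∷ u)
  rewrite insertAfter-here y v ys | insertAfter-∉ y v ys (λ y∈ → All.lookup y∉ y∈ refl) =
  cong ((y ∷ v ∷ ys) ∷_) (begin
    map (λ z → insertAfter z v (y ∷ ys)) ys ≡⟨ map-cong-local (All.map (insertAfter-there _ v y ys) y∉) ⟩
    map (λ z → y ∷ insertAfter z v ys) ys   ≡⟨ map-∘ ys ⟩
    map (y ∷_) (map (λ z → insertAfter z v ys) ys) ≡⟨ cong (map (y ∷_)) (map-insertAfter v ys u) ⟩
    map (y ∷_) (insertEverywhere v ys)      ∎)
  where open ≡-Reasoning

-- For v larger than every entry, #keeps s counts the positions after which inserting v does not
-- change the number of d-descents of s.
module InsertLargest (d v : ℕ) where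

  descent : ℕ → ℕ → ℕ
  descent y h = if d + h ≤ᵇ y then 1 else 0

  tooHigh : ℕ → ℕ
  tooHigh h = if d + h ≤ᵇ v then 0 else 1

  keeps : ℕ → ℕ → ℕ
  keeps y h = if d + h ≤ᵇ v then descent y h else 1

  #keeps : List ℕ → ℕ
  #keeps []          = 0
  #keeps (y ∷ [])    = 1
  #keeps (y ∷ h ∷ r) = keeps y h + #keeps (h ∷ r)

  countShifted : ℕ → ℕ → List (List ℕ) → ℕ
  countShifted m e = ∑ (λ t → 𝟙[ e + dDescents d t ≡ m ])

  descent-v : ∀ y → y < v → descent y v ≡ 0
  descent-v y y<v rewrite ≤ᵇ-false (d + v) y (λ d+v≤y → <⇒≱ y<v (≤-trans (m≤n+m v d) d+v≤y)) = refl

  descent⇒fits : ∀ y h → y < v → (d + h ≤ᵇ y) ≡ true → (d + h ≤ᵇ v) ≡ true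
  descent⇒fits y h y<v e = ≤ᵇ-true (d + h) v (≤-trans (≤ᵇ⇒≤ (d + h) y (subst T (sym e) _)) (<⇒≤ y<v))

  dDescents-snoc : ∀ s → All (_< v) s → dDescents d (s ++ [ v ]) ≡ dDescents d s
  dDescents-snoc []          _           = refl
  dDescents-snoc (y ∷ [])    (y<v ∷ [])  = cong (_+ 0) (descent-v y y<v)
  dDescents-snoc (y ∷ h ∷ r) (_ ∷ h∷r<v) = cong (descent y h +_) (dDescents-snoc (h ∷ r) h∷r<v)

  #keeps≤length : ∀ y r → #keeps (y ∷ r) ≤ length (y ∷ r)
  #keeps≤length y []      = ≤-refl
  #keeps≤length y (h ∷ r) = +-mono-≤ keeps≤1 (#keeps≤length h r)
    where
    keeps≤1 : keeps y h ≤ 1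
    keeps≤1 with d + h ≤ᵇ v | d + h ≤ᵇ y
    ... | true  | true  = ≤-refl
    ... | true  | false = z≤n
    ... | false | _     = ≤-refl

  #keeps≡ : ∀ y r → All (_< v) (y ∷ r) → #keeps (y ∷ r) ≡ suc (dDescents d (y ∷ r) + ∑ tooHigh r)
  #keeps≡ y []      _ = refl
  #keeps≡ y (h ∷ r) (y<v ∷ h∷r<v) rewrite #keeps≡ h r h∷r<v
    with d + h ≤ᵇ y in desc | d + h ≤ᵇ v in fits
  ... | true  | true  = cong suc (sym (+-assoc 1 (dDescents d (h ∷ r)) _))
  ... | true  | false with () ← trans (sym (descent⇒fits y h y<v desc)) fits
  ... | false | true  = refl
  ... | false | false = cong suc (sym (+-suc (dDescents d (h ∷ r)) _))

  countShifted-∷ : ∀ m e y h us →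
    countShifted m e (map (y ∷_) (map (h ∷_) us)) ≡ countShifted m (e + descent y h) (map (h ∷_) us)
  countShifted-∷ m e y h []       = refl
  countShifted-∷ m e y h (u ∷ us) =
    cong₂ _+_ (cong 𝟙[_≡ m ] (sym (+-assoc e (descent y h) _))) (countShifted-∷ m e y h us)

  countShifted-insertEverywhere : ∀ y r → All (_< v) (y ∷ r) → ∀ m e →
    let D = dDescents d (y ∷ r); K = #keeps (y ∷ r) in
    countShifted m e (insertEverywhere v (y ∷ r)) ≡
      𝟙[ e + D ≡ m ] * K + 𝟙[ e + suc D ≡ m ] * (length (y ∷ r) ∸ K)
  countShifted-insertEverywhere y [] (y<v ∷ []) m e
    rewrite descent-v y y<v | +-identityʳ e | *-zeroʳ 𝟙[ e + 1 ≡ m ] | *-identityʳ 𝟙[ e ≡ m ] = refl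
  countShifted-insertEverywhere y (h ∷ r) (y<v ∷ h∷r<v) m e = begin
    𝟙[ e + (descent y v + (descent v h + D′)) ≡ m ] + countShifted m e (map (y ∷_) (insertEverywhere v (h ∷ r)))
      ≡⟨ cong₂ (λ b c → 𝟙[ e + (b + (descent v h + D′)) ≡ m ] + c) (descent-v y y<v)
               (countShifted-∷ m e y h ((v ∷ r) ∷ insertEverywhere v r)) ⟩
    𝟙[ e + (descent v h + D′) ≡ m ] + countShifted m e′ (insertEverywhere v (h ∷ r))
      ≡⟨ cong (𝟙[ e + (descent v h + D′) ≡ m ] +_) (countShifted-insertEverywhere h r h∷r<v m e′) ⟩
    𝟙[ e + (descent v h + D′) ≡ m ] + (𝟙[ e′ + D′ ≡ m ] * K′ + 𝟙[ e′ + suc D′ ≡ m ] * (ℓ ∸ K′))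
      ≡⟨ split-cases ⟩
    𝟙[ e + (descent y h + D′) ≡ m ] * (keeps y h + K′) + 𝟙[ e + suc (descent y h + D′) ≡ m ] * (suc ℓ ∸ (keeps y h + K′))
      ∎
    where
    open ≡-Reasoning
    D′ = dDescents d (h ∷ r)
    K′ = #keeps (h ∷ r)
    ℓ  = length (h ∷ r)
    e′ = e + descent y h
    split-cases : 𝟙[ e + (descent v h + D′) ≡ m ] + (𝟙[ e′ + D′ ≡ m ] * K′ + 𝟙[ e′ + suc D′ ≡ m ] * (ℓ ∸ K′))
                ≡ 𝟙[ e + (descent y h + D′) ≡ m ] * (keeps y h + K′)
                  + 𝟙[ e + suc (descent y h + D′) ≡ m ] * (suc ℓ ∸ (keeps y h + K′))
    split-cases with d + h ≤ᵇ y in desc | d + h ≤ᵇ v in fits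
    ... | true  | false with () ← trans (sym (descent⇒fits y h y<v desc)) fits
    ... | true  | true
      rewrite +-assoc e 1 D′ | +-assoc e 1 (suc D′) | *-suc 𝟙[ e + suc D′ ≡ m ] K′ =
      sym (+-assoc 𝟙[ e + suc D′ ≡ m ] _ _)
    ... | false | true
      rewrite +-identityʳ e | +-∸-assoc 1 (#keeps≤length h r) | *-suc 𝟙[ e + suc D′ ≡ m ] (ℓ ∸ K′) =
      solve 3 (λ a b c → a :+ (b :+ c) := b :+ (a :+ c)) refl
        𝟙[ e + suc D′ ≡ m ] (𝟙[ e + D′ ≡ m ] * K′) (𝟙[ e + suc D′ ≡ m ] * (ℓ ∸ K′))
    ... | false | false rewrite +-identityʳ e | *-suc 𝟙[ e + D′ ≡ m ] K′ =
      sym (+-assoc 𝟙[ e + D′ ≡ m ] _ _)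

∑-range1-above : ∀ c n → ∑ (λ h → if h ≤ᵇ c then 0 else 1) (range1 n) ≡ n ∸ c
∑-range1-above c zero    = sym (0∸n≡0 c)
∑-range1-above c (suc n) = begin
  ∑ above (range1 (suc n))        ≡⟨ cong (∑ above) (range1-suc n) ⟩
  ∑ above (range1 n ++ [ suc n ]) ≡⟨ ∑-++ above (range1 n) [ suc n ] ⟩
  ∑ above (range1 n) + (above (suc n) + 0) ≡⟨ cong (_+ (above (suc n) + 0)) (∑-range1-above c n) ⟩
  n ∸ c + (above (suc n) + 0)     ≡⟨ last-step (suc n ≤? c) ⟩
  suc n ∸ c                       ∎
  where
  open ≡-Reasoning
  above : ℕ → ℕ
  above h = if h ≤ᵇ c then 0 else 1
  last-step : Dec (suc n ≤ c) → n ∸ c + (above (suc n) + 0) ≡ suc n ∸ c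
  last-step (yes n<c) rewrite ≤ᵇ-true (suc n) c n<c | m≤n⇒m∸n≡0 (<⇒≤ n<c) | m≤n⇒m∸n≡0 n<c = refl
  last-step (no n≮c) rewrite ≤ᵇ-false (suc n) c n≮c =
    trans (+-comm (n ∸ c) 1) (sym (+-∸-assoc 1 (≤-pred (≰⇒> n≮c))))

module _ {d n : ℕ} (1≤d : 1 ≤ d) (d≤n : d ≤ n) where
  open InsertLargest d (suc n)

  ∑-tooHigh : ∀ {t} → (1 ∷ t) ↭ range1 n → ∑ tooHigh t ≡ d ∸ 1
  ∑-tooHigh {t} 1∷t↭ = begin
    ∑ tooHigh t               ≡⟨ cong (_+ ∑ tooHigh t) tooHigh-1 ⟨
    ∑ tooHigh (1 ∷ t)         ≡⟨ ∑-↭ tooHigh 1∷t↭ ⟩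
    ∑ tooHigh (range1 n)
      ≡⟨ ∑-cong (range1 n) (λ {h} _ → cong (λ b → if b then 0 else 1) (≤ᵇ-shift d h (suc n) d≤n+1)) ⟩
    ∑ (λ h → if h ≤ᵇ suc n ∸ d then 0 else 1) (range1 n) ≡⟨ ∑-range1-above (suc n ∸ d) n ⟩
    n ∸ (suc n ∸ d)           ≡⟨ n∸[n+1∸d]≡d∸1 d 1≤d d≤n ⟩
    d ∸ 1                     ∎
    where
    open ≡-Reasoning
    d≤n+1 = m≤n⇒m≤1+n d≤n
    tooHigh-1 : tooHigh 1 ≡ 0
    tooHigh-1 rewrite ≤ᵇ-true (d + 1) (suc n) (subst (_≤ suc n) (+-comm 1 d) (s≤s d≤n)) = refl
    n∸[n+1∸d]≡d∸1 : ∀ d → 1 ≤ d → d ≤ n → n ∸ (suc n ∸ d) ≡ d ∸ 1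
    n∸[n+1∸d]≡d∸1 (suc d′) _ d≤n = m∸[m∸n]≡n (≤-trans (n≤1+n d′) d≤n)

  ∑-flatInsertMax : ∀ {t} m → (1 ∷ t) ↭ range1 n →
    let s = 1 ∷ t; D = dDescents d s in
    ∑ (λ x → 𝟙[ dDescents d (flatInsertMax n s x) ≡ m ]) (upTo (suc n))
      ≡ 𝟙[ D ≡ m ] * (D + d + 1) + 𝟙[ suc D ≡ m ] * (n ∸ (D + d))
  ∑-flatInsertMax {t} m s↭ = begin
    ∑ (λ x → 𝟙[ D (flatInsertMax n s x) ≡ m ]) (upTo (suc n))
      ≡⟨ ∑-upTo-suc (λ x → 𝟙[ D (flatInsertMax n s x) ≡ m ]) n ⟩
    𝟙[ D (s ++ [ suc n ]) ≡ m ] + ∑ (λ x → after (suc x)) (upTo n)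
      ≡⟨ cong (𝟙[ D (s ++ [ suc n ]) ≡ m ] +_) (∑-map after suc (upTo n)) ⟨
    𝟙[ D (s ++ [ suc n ]) ≡ m ] + ∑ after (range1 n)
      ≡⟨ cong₂ _+_ (cong 𝟙[_≡ m ] (dDescents-snoc s s<n+1)) (∑-↭ after (↭-sym s↭)) ⟩
    𝟙[ D s ≡ m ] + ∑ after s
      ≡⟨ cong (𝟙[ D s ≡ m ] +_) (trans (cong (countShifted m 0) (sym (map-insertAfter (suc n) s s-unique)))
                                      (∑-map (λ u → 𝟙[ D u ≡ m ]) (λ y → insertAfter y (suc n) s) s)) ⟨
    𝟙[ D s ≡ m ] + countShifted m 0 (insertEverywhere (suc n) s)
      ≡⟨ cong (𝟙[ D s ≡ m ] +_) (countShifted-insertEverywhere 1 t s<n+1 m 0) ⟩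
    𝟙[ D s ≡ m ] + (𝟙[ D s ≡ m ] * K + 𝟙[ suc (D s) ≡ m ] * (length s ∸ K))
      ≡⟨ cong₂ (λ k ℓ → 𝟙[ D s ≡ m ] + (𝟙[ D s ≡ m ] * k + 𝟙[ suc (D s) ≡ m ] * (ℓ ∸ k)))
               #keeps-s (length-↭-range1 s↭) ⟩
    𝟙[ D s ≡ m ] + (𝟙[ D s ≡ m ] * (D s + d) + 𝟙[ suc (D s) ≡ m ] * (n ∸ (D s + d)))
      ≡⟨ solve 4 (λ i D′ j r → i :+ (i :* D′ :+ j :* r) := i :* (D′ :+ con 1) :+ j :* r) refl
           𝟙[ D s ≡ m ] (D s + d) 𝟙[ suc (D s) ≡ m ] (n ∸ (D s + d)) ⟩
    𝟙[ D s ≡ m ] * (D s + d + 1) + 𝟙[ suc (D s) ≡ m ] * (n ∸ (D s + d))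
      ∎
    where
    open ≡-Reasoning
    s = 1 ∷ t
    D = dDescents d
    K = #keeps s
    after : ℕ → ℕ
    after y = 𝟙[ D (insertAfter y (suc n) s) ≡ m ]
    s<n+1 : All (_< suc n) s
    s<n+1 = All.tabulate (λ y∈ → s≤s (proj₂ (∈-range1⁻ n (∈-resp-↭ s↭ y∈))))
    s-unique : Unique s
    s-unique = Unique-resp-↭ (↭-sym s↭) (range1-unique n)
    #keeps-s : K ≡ D s + d
    #keeps-s = begin
      #keeps s                      ≡⟨ #keeps≡ 1 t s<n+1 ⟩
      suc (D s + ∑ tooHigh t)       ≡⟨ cong (λ k → suc (D s + k)) (∑-tooHigh s↭) ⟩
      suc (D s + (d ∸ 1))           ≡⟨ +-suc (D s) (d ∸ 1) ⟨
      D s + suc (d ∸ 1)             ≡⟨ cong (D s +_) (m+[n∸m]≡n 1≤d) ⟩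
      D s + d                       ∎

  ∑-insertMax : ∀ {w} m → w ∈ allPerms n →
    let D = flatDesc d w in
    ∑ (λ x → 𝟙[ flatDesc d (insertMax n w x) ≡ m ]) (upTo (suc n))
      ≡ 𝟙[ D ≡ m ] * (D + d + 1) + 𝟙[ suc D ≡ m ] * (n ∸ (D + d))
  ∑-insertMax {w} m w∈ with All.lookup (allPerms-flatten n) w∈
  ... | s , F with Flattens-startsWith1 (≤-trans 1≤d d≤n) F
  ... | t , refl = begin
    ∑ (λ x → 𝟙[ flatDesc d (insertMax n w x) ≡ m ]) (upTo (suc n))
      ≡⟨ ∑-cong (upTo (suc n)) (λ x∈ → cong (λ u → 𝟙[ dDescents d u ≡ m ])
           (Flattens⇒Flatten≡ (Flattens-insertMax _ (≤-pred (∈-upTo⁻ x∈)) F))) ⟩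
    ∑ (λ x → 𝟙[ dDescents d (flatInsertMax n s x) ≡ m ]) (upTo (suc n))
      ≡⟨ ∑-flatInsertMax m (flatPerm F) ⟩
    𝟙[ D ≡ m ] * (D + d + 1) + 𝟙[ suc D ≡ m ] * (n ∸ (D + d))
      ≡⟨ cong (λ k → 𝟙[ k ≡ m ] * (k + d + 1) + 𝟙[ suc k ≡ m ] * (n ∸ (k + d)))
              (cong (dDescents d) (Flattens⇒Flatten≡ F)) ⟨
    𝟙[ flatDesc d w ≡ m ] * (flatDesc d w + d + 1) + 𝟙[ suc (flatDesc d w) ≡ m ] * (n ∸ (flatDesc d w + d))
      ∎
    where
    open ≡-Reasoning
    D = dDescents d s

-- The recurrence for a(n, m)

module _ {d n : ℕ} (1≤d : 1 ≤ d) (d≤n : d ≤ n) where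
  private
    D : List ℕ → ℕ
    D = flatDesc d
    count : ℕ → ℕ → ℕ
    count k m = countFlat d m (allPerms k)
    promoted : ℕ → ℕ
    promoted m = ∑ (λ w → 𝟙[ suc (D w) ≡ m ] * (n ∸ (D w + d))) (allPerms n)

  countFlat-allPerms-suc : ∀ m → count (suc n) m ≡ (m + d + 1) * count n m + promoted m
  countFlat-allPerms-suc m = begin
    countFlat d m (allPerms (suc n))
      ≡⟨ countFlat≡∑ d m (allPerms (suc n)) ⟩
    ∑ (λ σ → 𝟙[ D σ ≡ m ]) (concatMap (λ w → map (insertMax n w) (upTo (suc n))) (allPerms n))
      ≡⟨ ∑-concatMap _ (λ w → map (insertMax n w) (upTo (suc n))) (allPerms n) ⟩
    ∑ (λ w → ∑ (λ σ → 𝟙[ D σ ≡ m ]) (map (insertMax n w) (upTo (suc n)))) (allPerms n)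
      ≡⟨ ∑-cong (allPerms n) (λ {w} w∈ → trans (∑-map _ (insertMax n w) (upTo (suc n))) (∑-insertMax 1≤d d≤n m w∈)) ⟩
    ∑ (λ w → 𝟙[ D w ≡ m ] * (D w + d + 1) + 𝟙[ suc (D w) ≡ m ] * (n ∸ (D w + d))) (allPerms n)
      ≡⟨ ∑-+ _ _ (allPerms n) ⟩
    ∑ (λ w → 𝟙[ D w ≡ m ] * (D w + d + 1)) (allPerms n) + promoted m
      ≡⟨ cong (_+ promoted m) (∑-𝟙-subst D (λ k → k + d + 1) m (allPerms n)) ⟩
    (m + d + 1) * ∑ (λ w → 𝟙[ D w ≡ m ]) (allPerms n) + promoted m
      ≡⟨ cong (λ c → (m + d + 1) * c + promoted m) (countFlat≡∑ d m (allPerms n)) ⟨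
    (m + d + 1) * count n m + promoted m
      ∎
    where open ≡-Reasoning

  countFlat-allPerms-suc-zero : count (suc n) 0 ≡ (d + 1) * count n 0
  countFlat-allPerms-suc-zero =
    trans (countFlat-allPerms-suc 0) (trans (cong ((d + 1) * count n 0 +_) (∑-const 0 (allPerms n))) (+-identityʳ _))

  countFlat-allPerms-suc-suc : ∀ m →
    count (suc n) (suc m) ≡ (suc m + d + 1) * count n (suc m) + (n ∸ (m + d)) * count n m
  countFlat-allPerms-suc-suc m = trans (countFlat-allPerms-suc (suc m)) (cong ((suc m + d + 1) * count n (suc m) +_)
    (trans (∑-𝟙-subst D (λ k → n ∸ (k + d)) m (allPerms n)) (cong ((n ∸ (m + d)) *_) (sym (countFlat≡∑ d m (allPerms n))))))

length-allPerms : ∀ n → length (allPerms n) ≡ n !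
length-allPerms zero    = refl
length-allPerms (suc n) = begin
  length (allPerms (suc n))
    ≡⟨ length-concatMap (λ w → map (insertMax n w) (upTo (suc n))) (allPerms n) ⟩
  ∑ (λ w → length (map (insertMax n w) (upTo (suc n)))) (allPerms n)
    ≡⟨ ∑-cong (allPerms n) (λ {w} _ → trans (length-map (insertMax n w) (upTo (suc n))) (length-upTo (suc n))) ⟩
  ∑ (λ _ → suc n) (allPerms n)
    ≡⟨ ∑-const (suc n) (allPerms n) ⟩
  suc n * length (allPerms n)
    ≡⟨ cong (suc n *_) (length-allPerms n) ⟩
  suc n * n !
    ∎
  where open ≡-Reasoning

dDescents-InRange : ∀ d s → All (InRange d) s → dDescents d s ≡ 0
dDescents-InRange d []          _ = refl
dDescents-InRange d (y ∷ [])    _ = refl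
dDescents-InRange d (y ∷ h ∷ r) ((_ , y≤d) ∷ h∷r∈@((1≤h , _) ∷ _)) rewrite dDescents-InRange d (h ∷ r) h∷r∈ =
  cong (λ b → (if b then 1 else 0) + 0) (≤ᵇ-false (d + h) y (λ d+h≤y → <⇒≱ y<d+h d+h≤y))
  where
  y<d+h : y < d + h
  y<d+h = ≤-trans (s≤s y≤d) (subst (_≤ d + h) (+-comm d 1) (+-monoʳ-≤ d 1≤h))

countFlat-allPerms-base : ∀ d m → countFlat d m (allPerms d) ≡ 𝟙[ 0 ≡ m ] * d !
countFlat-allPerms-base d m = begin
  countFlat d m (allPerms d)              ≡⟨ countFlat≡∑ d m (allPerms d) ⟩
  ∑ (λ σ → 𝟙[ flatDesc d σ ≡ m ]) (allPerms d) ≡⟨ ∑-cong (allPerms d) (cong 𝟙[_≡ m ] ∘′ no-descents) ⟩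
  ∑ (λ _ → 𝟙[ 0 ≡ m ]) (allPerms d)       ≡⟨ ∑-const 𝟙[ 0 ≡ m ] (allPerms d) ⟩
  𝟙[ 0 ≡ m ] * length (allPerms d)        ≡⟨ cong (𝟙[ 0 ≡ m ] *_) (length-allPerms d) ⟩
  𝟙[ 0 ≡ m ] * d !                         ∎
  where
  open ≡-Reasoning
  no-descents : ∀ {w} → w ∈ allPerms d → flatDesc d w ≡ 0
  no-descents w∈ with All.lookup (allPerms-flatten d) w∈
  ... | s , F = trans (cong (dDescents d) (Flattens⇒Flatten≡ F))
                      (dDescents-InRange d s (All.tabulate (∈-range1⁻ d ∘′ ∈-resp-↭ (flatPerm F))))

-- Sums over compositions

NonEmpty : List ℕ → Set
NonEmpty c = ∃₂ λ x r → c ≡ x ∷ r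

compositions-nonEmpty : ∀ k K → All NonEmpty (compositions (suc k) K)
compositions-nonEmpty k K =
  All.concat⁺ (All.map⁺ {f = λ i → map (i ∷_) (compositions k (K ∸ i))}
    (All.tabulate {xs = upTo (suc K)} (λ {i} _ → All.map⁺ (All.tabulate (λ {c} _ → i , c , refl)))))

module CompositionSums (d : ℕ) where

  weightFrom : ℕ → ℕ → List ℕ → ℕ
  weightFrom s j c = prefixProd s c * powProd d j c

  compSum : ℕ → ℕ → ℕ → ℕ → ℕ
  compSum k s j K = ∑ (weightFrom s j) (compositions k K)

  firstFactor : ℕ → ℕ → ℕ → ℕ
  firstFactor s j i = (s + i + 1) * (d + j) ^ i

  ∑-weightFrom-∷ : ∀ s j i cs → All NonEmpty cs →
    ∑ (weightFrom s j) (map (i ∷_) cs) ≡ firstFactor s j i * ∑ (weightFrom (s + i) (suc j)) cs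
  ∑-weightFrom-∷ s j i []                  []                = sym (*-zeroʳ (firstFactor s j i))
  ∑-weightFrom-∷ s j i (.(x ∷ r) ∷ cs) ((x , r , refl) ∷ ne) =
    trans (cong₂ _+_ ([m*n]*[o*p]≡[m*o]*[n*p] (s + i + 1) (prefixProd (s + i) (x ∷ r)) _ _)
                     (∑-weightFrom-∷ s j i cs ne))
          (sym (*-distribˡ-+ (firstFactor s j i) _ _))

  compSum-first : ∀ k s j K →
    compSum (2 + k) s j K ≡ ∑ (λ i → firstFactor s j i * compSum (suc k) (s + i) (suc j) (K ∸ i)) (upTo (suc K))
  compSum-first k s j K =
    trans (∑-concatMap (weightFrom s j) (λ i → map (i ∷_) (compositions (suc k) (K ∸ i))) (upTo (suc K)))
          (∑-upTo-cong (suc K) (λ {i} _ → ∑-weightFrom-∷ s j i _ (compositions-nonEmpty k (K ∸ i))))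

  compSum-one : ∀ s j K → compSum 1 s j K ≡ (d + j) ^ K
  compSum-one s j K = begin
    compSum 1 s j K                         ≡⟨ ∑-concatMap (weightFrom s j) single (upTo (suc K)) ⟩
    ∑ part (upTo (suc K))                   ≡⟨ ∑-upTo-snoc part K ⟩
    ∑ part (upTo K) + part K                ≡⟨ cong₂ _+_ (trans (∑-upTo-cong K part<K) (∑-const 0 (upTo K))) part-K ⟩
    (d + j) ^ K                             ∎
    where
    open ≡-Reasoning
    single : ℕ → List (List ℕ)
    single i = map (i ∷_) (compositions 0 (K ∸ i))
    part : ℕ → ℕ
    part i = ∑ (weightFrom s j) (single i)
    part<K : ∀ {i} → i < K → part i ≡ 0
    part<K {i} i<K with K ∸ i in eq
    ... | zero  = ⊥-elim (m>n⇒m∸n≢0 i<K eq)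
    ... | suc _ = refl
    part-K : part K ≡ (d + j) ^ K
    part-K rewrite n∸n≡0 K = trans (+-identityʳ _) (trans (*-identityˡ _) (*-identityʳ _))

  compSum-zero : ∀ k s j → compSum (suc k) s j 0 ≡ (s + 1) ^ k
  compSum-zero zero    s j = compSum-one s j 0
  compSum-zero (suc k) s j = begin
    compSum (2 + k) s j 0                              ≡⟨ compSum-first k s j 0 ⟩
    (s + 0 + 1) * 1 * compSum (suc k) (s + 0) (suc j) 0 + 0 ≡⟨ +-identityʳ _ ⟩
    (s + 0 + 1) * 1 * compSum (suc k) (s + 0) (suc j) 0 ≡⟨ cong (λ t → (t + 1) * 1 * compSum (suc k) t (suc j) 0) (+-identityʳ s) ⟩
    (s + 1) * 1 * compSum (suc k) s (suc j) 0          ≡⟨ cong₂ _*_ (*-identityʳ (s + 1)) (compSum-zero k s (suc j)) ⟩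
    (s + 1) * (s + 1) ^ k                              ∎
    where open ≡-Reasoning

  private
    ∸-suc : ∀ {i K} → i < suc K → suc K ∸ i ≡ suc (K ∸ i)
    ∸-suc (s≤s i≤K) = +-∸-assoc 1 i≤K

    +-suc-1 : ∀ s K → s + suc K + 1 ≡ s + K + 2
    +-suc-1 = solve 2 (λ s K → s :+ (con 1 :+ K) :+ con 1 := s :+ K :+ con 2) refl

  compSum-suc : ∀ k s j K →
    compSum (2 + k) s j (suc K) ≡ (d + j + suc k) * compSum (2 + k) s j K + (s + K + 2) * compSum (suc k) s j (suc K)
  compSum-suc zero s j K = begin
    compSum 2 s j (suc K)
      ≡⟨ compSum-first 0 s j (suc K) ⟩
    ∑ g (upTo (2 + K))
      ≡⟨ ∑-upTo-snoc g (suc K) ⟩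
    ∑ g (upTo (suc K)) + g (suc K)
      ≡⟨ cong₂ _+_ (∑-upTo-cong (suc K) g-shift) g-last ⟩
    ∑ (λ i → (d + suc j) * g′ i) (upTo (suc K)) + (s + K + 2) * compSum 1 s j (suc K)
      ≡⟨ cong (_+ (s + K + 2) * compSum 1 s j (suc K))
              (trans (∑-*ˡ (d + suc j) g′ (upTo (suc K))) (cong ((d + suc j) *_) (sym (compSum-first 0 s j K)))) ⟩
    (d + suc j) * compSum 2 s j K + (s + K + 2) * compSum 1 s j (suc K)
      ≡⟨ cong (λ c → c * compSum 2 s j K + (s + K + 2) * compSum 1 s j (suc K)) (+-suc d j) ⟩
    suc (d + j) * compSum 2 s j K + (s + K + 2) * compSum 1 s j (suc K)
      ≡⟨ cong (λ c → c * compSum 2 s j K + (s + K + 2) * compSum 1 s j (suc K)) (+-comm 1 (d + j)) ⟩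
    (d + j + 1) * compSum 2 s j K + (s + K + 2) * compSum 1 s j (suc K)
      ∎
    where
    open ≡-Reasoning
    g g′ : ℕ → ℕ
    g  i = firstFactor s j i * compSum 1 (s + i) (suc j) (suc K ∸ i)
    g′ i = firstFactor s j i * compSum 1 (s + i) (suc j) (K ∸ i)
    g-shift : ∀ {i} → i < suc K → g i ≡ (d + suc j) * g′ i
    g-shift {i} i<K+1 rewrite ∸-suc i<K+1 | compSum-one (s + i) (suc j) (suc (K ∸ i)) | compSum-one (s + i) (suc j) (K ∸ i) =
      x∙yz≈y∙xz (firstFactor s j i) (d + suc j) _
    g-last : g (suc K) ≡ (s + K + 2) * compSum 1 s j (suc K)
    g-last rewrite n∸n≡0 K | compSum-one (s + suc K) (suc j) 0 | compSum-one s j (suc K) | +-suc-1 s K =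
      *-identityʳ _
  compSum-suc (suc k) s j K = begin
    compSum (3 + k) s j (suc K)
      ≡⟨ compSum-first (suc k) s j (suc K) ⟩
    ∑ G (upTo (2 + K))
      ≡⟨ ∑-upTo-snoc G (suc K) ⟩
    ∑ G (upTo (suc K)) + G (suc K)
      ≡⟨ cong₂ _+_ (∑-upTo-cong (suc K) G-shift) G-last ⟩
    ∑ (λ i → c * X i + q * G′ i) (upTo (suc K)) + aK * (q * P)
      ≡⟨ cong (_+ aK * (q * P)) (trans (∑-+ (λ i → c * X i) (λ i → q * G′ i) (upTo (suc K)))
           (cong₂ _+_ (trans (∑-*ˡ c X (upTo (suc K))) (cong (c *_) (sym (compSum-first (suc k) s j K))))
                      (∑-*ˡ q G′ (upTo (suc K))))) ⟩
    c * compSum (3 + k) s j K + q * ∑ G′ (upTo (suc K)) + aK * (q * P)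
      ≡⟨ solve 6 (λ c X q Y A P → c :* X :+ q :* Y :+ A :* (q :* P) := c :* X :+ q :* (Y :+ A :* P)) refl
           c (compSum (3 + k) s j K) q (∑ G′ (upTo (suc K))) aK P ⟩
    c * compSum (3 + k) s j K + q * (∑ G′ (upTo (suc K)) + aK * P)
      ≡⟨ cong₂ (λ u v → u * compSum (3 + k) s j K + q * v) c≡
           (sym (trans (compSum-first k s j (suc K)) (trans (∑-upTo-snoc G′ (suc K)) (cong (∑ G′ (upTo (suc K)) +_) G′-last)))) ⟩
    (d + j + suc (suc k)) * compSum (3 + k) s j K + q * compSum (2 + k) s j (suc K)
      ∎
    where
    open ≡-Reasoning
    c = d + suc j + suc k
    q = s + K + 2
    aK = firstFactor s j (suc K)
    P = (s + K + 2) ^ k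
    c≡ : c ≡ d + j + suc (suc k)
    c≡ = trans (cong (_+ suc k) (+-suc d j)) (sym (+-suc (d + j) (suc k)))
    G G′ X : ℕ → ℕ
    G  i = firstFactor s j i * compSum (2 + k) (s + i) (suc j) (suc K ∸ i)
    G′ i = firstFactor s j i * compSum (1 + k) (s + i) (suc j) (suc K ∸ i)
    X  i = firstFactor s j i * compSum (2 + k) (s + i) (suc j) (K ∸ i)
    G-shift : ∀ {i} → i < suc K → G i ≡ c * X i + q * G′ i
    G-shift {i} i<K+1
      rewrite ∸-suc i<K+1 | compSum-suc k (s + i) (suc j) (K ∸ i)
            | +-assoc s i (K ∸ i) | m+[n∸m]≡n (≤-pred i<K+1) =
      solve 5 (λ x c h q h′ → x :* (c :* h :+ q :* h′) := c :* (x :* h) :+ q :* (x :* h′)) refl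
        (firstFactor s j i) c (compSum (2 + k) (s + i) (suc j) (K ∸ i)) q (compSum (1 + k) (s + i) (suc j) (suc (K ∸ i)))
    G-last : G (suc K) ≡ aK * (q * P)
    G-last rewrite n∸n≡0 K | compSum-zero (suc k) (s + suc K) (suc j) | +-suc-1 s K = refl
    G′-last : G′ (suc K) ≡ aK * P
    G′-last rewrite n∸n≡0 K | compSum-zero k (s + suc K) (suc j) | +-suc-1 s K = refl

-- a(t + d, m) / d!, by countFlat-allPerms.
descentNumber : ℕ → ℕ → ℕ → ℕ
descentNumber d zero    zero    = 1
descentNumber d zero    (suc m) = 0
descentNumber d (suc t) zero    = (d + 1) * descentNumber d t zero
descentNumber d (suc t) (suc m) = (suc m + d + 1) * descentNumber d t (suc m) + (t ∸ m) * descentNumber d t m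

countFlat-allPerms : ∀ {d} → 1 ≤ d → ∀ t m → countFlat d m (allPerms (t + d)) ≡ d ! * descentNumber d t m
countFlat-allPerms {d} 1≤d zero zero    = trans (countFlat-allPerms-base d 0) (*-comm 1 (d !))
countFlat-allPerms {d} 1≤d zero (suc m) = trans (countFlat-allPerms-base d (suc m)) (sym (*-zeroʳ (d !)))
countFlat-allPerms {d} 1≤d (suc t) zero = begin
  countFlat d 0 (allPerms (suc t + d))      ≡⟨ countFlat-allPerms-suc-zero 1≤d (m≤n+m d t) ⟩
  (d + 1) * countFlat d 0 (allPerms (t + d)) ≡⟨ cong ((d + 1) *_) (countFlat-allPerms 1≤d t 0) ⟩
  (d + 1) * (d ! * descentNumber d t 0)     ≡⟨ x∙yz≈y∙xz (d + 1) (d !) _ ⟩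
  d ! * ((d + 1) * descentNumber d t 0)     ∎
  where open ≡-Reasoning
countFlat-allPerms {d} 1≤d (suc t) (suc m) = begin
  countFlat d (suc m) (allPerms (suc t + d))
    ≡⟨ countFlat-allPerms-suc-suc 1≤d (m≤n+m d t) m ⟩
  (suc m + d + 1) * countFlat d (suc m) (allPerms (t + d)) + (t + d ∸ (m + d)) * countFlat d m (allPerms (t + d))
    ≡⟨ cong₂ (λ x y → (suc m + d + 1) * x + (t + d ∸ (m + d)) * y)
             (countFlat-allPerms 1≤d t (suc m)) (countFlat-allPerms 1≤d t m) ⟩
  (suc m + d + 1) * (d ! * descentNumber d t (suc m)) + (t + d ∸ (m + d)) * (d ! * descentNumber d t m)
    ≡⟨ cong (λ c → (suc m + d + 1) * (d ! * descentNumber d t (suc m)) + c * (d ! * descentNumber d t m))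
            (trans (cong₂ _∸_ (+-comm t d) (+-comm m d)) ([m+n]∸[m+o]≡n∸o d t m)) ⟩
  (suc m + d + 1) * (d ! * descentNumber d t (suc m)) + (t ∸ m) * (d ! * descentNumber d t m)
    ≡⟨ solve 5 (λ a f x b y → a :* (f :* x) :+ b :* (f :* y) := f :* (a :* x :+ b :* y)) refl
         (suc m + d + 1) (d !) (descentNumber d t (suc m)) (t ∸ m) (descentNumber d t m) ⟩
  d ! * descentNumber d (suc t) (suc m)
    ∎
  where open ≡-Reasoning

descentNumber-vanishes : ∀ d t m → t ≤ suc m → descentNumber d t (suc m) ≡ 0
descentNumber-vanishes d zero    m _ = refl
descentNumber-vanishes d (suc t) m (s≤s t≤m)
  rewrite descentNumber-vanishes d t m (m≤n⇒m≤1+n t≤m) | m≤n⇒m∸n≡0 t≤m =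
    trans (+-identityʳ _) (*-zeroʳ (suc m + d + 1))

module _ (d : ℕ) where
  open CompositionSums d

  descentNumber≡compSum : ∀ m K → descentNumber d (suc (m + K)) m ≡ suc d * compSum (suc m) 0 1 K
  descentNumber≡compSum zero zero = cong (_* 1) (+-comm d 1)
  descentNumber≡compSum zero (suc K) = begin
    (d + 1) * descentNumber d (suc K) 0 ≡⟨ cong ((d + 1) *_) (descentNumber≡compSum 0 K) ⟩
    (d + 1) * (suc d * compSum 1 0 1 K) ≡⟨ x∙yz≈y∙xz (d + 1) (suc d) _ ⟩
    suc d * ((d + 1) * compSum 1 0 1 K) ≡⟨ cong (λ c → suc d * ((d + 1) * c)) (compSum-one 0 1 K) ⟩
    suc d * (d + 1) ^ suc K             ≡⟨ cong (suc d *_) (compSum-one 0 1 (suc K)) ⟨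
    suc d * compSum 1 0 1 (suc K)       ∎
    where open ≡-Reasoning
  descentNumber≡compSum (suc m) zero
    rewrite descentNumber-vanishes d (suc m + 0) m (≤-reflexive (+-identityʳ (suc m)))
          | +-identityʳ m | +-∸-assoc 1 (≤-refl {m}) | n∸n≡0 m = begin
    (suc m + d + 1) * 0 + 1 * descentNumber d (suc m) m ≡⟨ cong₂ _+_ (*-zeroʳ (suc m + d + 1)) (*-identityˡ _) ⟩
    descentNumber d (suc m) m                          ≡⟨ cong (λ k → descentNumber d (suc k) m) (+-identityʳ m) ⟨
    descentNumber d (suc (m + 0)) m                    ≡⟨ descentNumber≡compSum m 0 ⟩
    suc d * compSum (suc m) 0 1 0                      ≡⟨ cong (suc d *_) (trans (compSum-zero m 0 1) (^-zeroˡ m)) ⟩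
    suc d * 1                                          ≡⟨ cong (suc d *_) (trans (compSum-zero (suc m) 0 1) (^-zeroˡ (suc m))) ⟨
    suc d * compSum (2 + m) 0 1 0                      ∎
    where open ≡-Reasoning
  descentNumber≡compSum (suc m) (suc K) = begin
    (suc m + d + 1) * descentNumber d (suc m + suc K) (suc m) + (suc m + suc K ∸ m) * descentNumber d (suc (m + suc K)) m
      ≡⟨ cong₂ (λ x y → (suc m + d + 1) * x + y * descentNumber d (suc (m + suc K)) m)
               (trans (cong (λ k → descentNumber d (suc k) (suc m)) (+-suc m K)) (descentNumber≡compSum (suc m) K))
               (trans (cong (_∸ m) (sym (+-suc m (suc K)))) (m+n∸m≡n m (2 + K))) ⟩
    (suc m + d + 1) * (suc d * compSum (2 + m) 0 1 K) + (2 + K) * descentNumber d (suc (m + suc K)) m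
      ≡⟨ cong (λ y → (suc m + d + 1) * (suc d * compSum (2 + m) 0 1 K) + (2 + K) * y) (descentNumber≡compSum m (suc K)) ⟩
    (suc m + d + 1) * (suc d * compSum (2 + m) 0 1 K) + (2 + K) * (suc d * compSum (suc m) 0 1 (suc K))
      ≡⟨ solve 5 (λ a f x b y → a :* (f :* x) :+ b :* (f :* y) := f :* (a :* x :+ b :* y)) refl
           (suc m + d + 1) (suc d) (compSum (2 + m) 0 1 K) (2 + K) (compSum (suc m) 0 1 (suc K)) ⟩
    suc d * ((suc m + d + 1) * compSum (2 + m) 0 1 K + (2 + K) * compSum (suc m) 0 1 (suc K))
      ≡⟨ cong₂ (λ a b → suc d * (a * compSum (2 + m) 0 1 K + b * compSum (suc m) 0 1 (suc K)))
               (solve 2 (λ d m → con 1 :+ m :+ d :+ con 1 := d :+ con 1 :+ (con 1 :+ m)) refl d m) (+-comm 2 K) ⟩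
    suc d * ((d + 1 + suc m) * compSum (2 + m) 0 1 K + (K + 2) * compSum (suc m) 0 1 (suc K))
      ≡⟨ cong (suc d *_) (compSum-suc m 0 1 K) ⟨
    suc d * compSum (2 + m) 0 1 (suc K)
      ∎
    where open ≡-Reasoning

n≡[m+K+1]+d : ∀ m d {n} → m + d < n → suc (m + (n ∸ 1 ∸ d ∸ m)) + d ≡ n
n≡[m+K+1]+d m d {suc n} (s≤s m+d≤n) = cong suc (begin
  m + (n ∸ d ∸ m) + d ≡⟨ cong (_+ d) (m+[n∸m]≡n (m+n≤o⇒m≤o∸n m m+d≤n)) ⟩
  n ∸ d + d           ≡⟨ m∸n+n≡m (≤-trans (m≤n+m d m) m+d≤n) ⟩
  n                   ∎)
  where open ≡-Reasoning

proposition2p7 : (d m n : ℕ) → 1 ≤ d → m + d + 1 ≤ n →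
    (perms : List (List ℕ)) → Unique perms →
    (∀ σ → (σ ∈ perms) ⇔ (σ ↭ range1 n)) →
    countFlat d m perms ≡ (suc d) ! * rhs n m d
proposition2p7 d m n 1≤d m+d+1≤n perms unique ∈perms⇔ = begin
  countFlat d m perms                          ≡⟨ countFlat-↭ d m (allPerms↭ n perms unique ∈perms⇔) ⟩
  countFlat d m (allPerms n)                   ≡⟨ cong (countFlat d m ∘′ allPerms) n≡ ⟨
  countFlat d m (allPerms (suc (m + K) + d))   ≡⟨ countFlat-allPerms 1≤d (suc (m + K)) m ⟩
  d ! * descentNumber d (suc (m + K)) m        ≡⟨ cong (d ! *_) (descentNumber≡compSum d m K) ⟩
  d ! * (suc d * rhs n m d)                    ≡⟨ x∙yz≈y∙xz (d !) (suc d) _ ⟩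
  suc d * (d ! * rhs n m d)                    ≡⟨ *-assoc (suc d) (d !) _ ⟨
  suc d ! * rhs n m d                          ∎
  where
  open ≡-Reasoning
  K = n ∸ 1 ∸ d ∸ m
  n≡ = n≡[m+K+1]+d m d (subst (_≤ n) (+-comm (m + d) 1) m+d+1≤n)
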